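{- Let $p$ be a prime, $q=p^d$, and let $V=\mathbb{F}_p^{dm}$ be the vertex set of $H(m,q)$ (alphabet $\mathbb{F}_p^d$). Let $W$ be a $k$-dimensional $\mathbb{F}_p$-subspace of $V$ with $1\leq k\leq d$ such that $W$ is an $(X,2)$-neighbour-transitive code with minimum distance $\delta\geq 5$, for some $X\leq\mathrm{Aut}(W)$. Then $q=2$ and $W$ is the binary repetition code $\{(0,\ldots,0),(1,\ldots,1)\}$ in $H(m,2)$.
   Context: The Hamming graph $H(m,q)$ has vertex set $Q^m$, vertices adjacent iff they differ in exactly one entry. For a code $D$, $D_s$ is the set of vertices at distance exactly $s$ from $D$; minimum distance is the least distance between distinct elements of $D$. $\mathrm{Aut}(W)$ is the setwise stabiliser of $W$ in $\mathrm{Aut}(H(m,q))$, and $W$ is $(X,2)$-neighbour-transitive if $X$ is transitive on each of $W$, $W_1$, $W_2$. -}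

module Defs where

open import Data.Nat using (ℕ; zero; suc; _+_; _*_; _≤_; NonZero)
open import Data.Nat.DivMod using (_%_; m%n<n)
open import Data.Fin using (Fin; toℕ; fromℕ<)
open import Data.Fin.Properties using (_≟_)
open import Data.Vec using (Vec; []; _∷_; replicate; zipWith; map; foldr)
open import Data.Vec.Properties using (≡-dec)
open import Data.Product using (Σ; _×_; _,_)
open import Relation.Nullary using (yes; no; ¬_)
open import Relation.Binary.PropositionalEquality using (_≡_)
open import Function.Bundles using (_⇔_)

-- The prime field F_p, realised as Fin p with arithmetic modulo p.
_+F_ : {p : ℕ} .{{_ : NonZero p}} → Fin p → Fin p → Fin p
_+F_ {p} a b = fromℕ< (m%n<n (toℕ a + toℕ b) p)

_*F_ : {p : ℕ} .{{_ : NonZero p}} → Fin p → Fin p → Fin p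
_*F_ {p} a b = fromℕ< (m%n<n (toℕ a * toℕ b) p)

zeroF : {p : ℕ} .{{_ : NonZero p}} → Fin p
zeroF {p} = fromℕ< (m%n<n 0 p)

oneF : {p : ℕ} .{{_ : NonZero p}} → Fin p
oneF {p} = fromℕ< (m%n<n 1 p)

-- Alphabet Q = F_p^d (q = p^d letters); vertices of H(m,q) are words Q^m = F_p^{dm}.
Q : ℕ → ℕ → Set
Q p d = Vec (Fin p) d

V : ℕ → ℕ → ℕ → Set
V p d m = Vec (Q p d) m

addV : {p d m : ℕ} .{{_ : NonZero p}} → V p d m → V p d m → V p d m
addV = zipWith (zipWith _+F_)

scaleV : {p d m : ℕ} .{{_ : NonZero p}} → Fin p → V p d m → V p d m
scaleV c = map (map (c *F_))

zeroV : {p d m : ℕ} .{{_ : NonZero p}} → V p d m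
zeroV {p} {d} {m} = replicate m (replicate d zeroF)

onesV : {p d m : ℕ} .{{_ : NonZero p}} → V p d m
onesV {p} {d} {m} = replicate m (replicate d oneF)

-- Hamming distance: number of entries (letters of Q) in which two words differ.
dist : {p d m : ℕ} → V p d m → V p d m → ℕ
dist [] [] = 0
dist (x ∷ xs) (y ∷ ys) with ≡-dec _≟_ x y
... | yes _ = dist xs ys
... | no _ = suc (dist xs ys)

Adj : {p d m : ℕ} → V p d m → V p d m → Set
Adj u v = dist u v ≡ 1

record HammingAut (p d m : ℕ) : Set where
  field
    fun : V p d m → V p d m
    inv : V p d m → V p d m
    inv-left : ∀ v → inv (fun v) ≡ v
    inv-right : ∀ v → fun (inv v) ≡ v
    adj : ∀ u v → Adj u v ⇔ Adj (fun u) (fun v)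
open HammingAut public

Code : ℕ → ℕ → ℕ → Set₁
Code p d m = V p d m → Set

IsSubspace : {p d m : ℕ} .{{_ : NonZero p}} → Code p d m → Set
IsSubspace {p} {d} {m} W =
  W zeroV
  × (∀ u v → W u → W v → W (addV u v))
  × (∀ (c : Fin p) v → W v → W (scaleV c v))

lincomb : {p d m k : ℕ} .{{_ : NonZero p}} → Vec (V p d m) k → Vec (Fin p) k → V p d m
lincomb b c = foldr _ addV zeroV (zipWith scaleV c b)

HasDim : {p d m : ℕ} .{{_ : NonZero p}} → Code p d m → ℕ → Set
HasDim {p} {d} {m} W k =
  Σ (Vec (V p d m) k) λ b →
    (∀ c → W (lincomb b c))
    × (∀ w → W w → Σ (Vec (Fin p) k) λ c → lincomb b c ≡ w)
    × (∀ c c' → lincomb b c ≡ lincomb b c' → c ≡ c')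

IsSubgroup : {p d m : ℕ} → (HammingAut p d m → Set) → Set
IsSubgroup {p} {d} {m} X =
  (Σ (HammingAut p d m) λ e → X e × (∀ v → fun e v ≡ v))
  × (∀ x y → X x → X y → Σ (HammingAut p d m) λ z → X z × (∀ v → fun z v ≡ fun x (fun y v)))
  × (∀ x → X x → Σ (HammingAut p d m) λ y → X y × (∀ v → fun y v ≡ inv x v))

Stabilises : {p d m : ℕ} → Code p d m → HammingAut p d m → Set
Stabilises W g = ∀ v → W v ⇔ W (fun g v)

DistSet : {p d m : ℕ} → Code p d m → ℕ → Code p d m
DistSet {p} {d} {m} W s v =
  (Σ (V p d m) λ w → W w × dist v w ≡ s) × (∀ w → W w → s ≤ dist v w)

TransitiveOn : {p d m : ℕ} → (HammingAut p d m → Set) → Code p d m → Set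
TransitiveOn {p} {d} {m} X S =
  ∀ u v → S u → S v → Σ (HammingAut p d m) λ x → X x × fun x u ≡ v

NeighbourTransitive2 : {p d m : ℕ} → (HammingAut p d m → Set) → Code p d m → Set
NeighbourTransitive2 X W =
  TransitiveOn X W × TransitiveOn X (DistSet W 1) × TransitiveOn X (DistSet W 2)

MinDistAtLeast : {p d m : ℕ} → ℕ → Code p d m → Set
MinDistAtLeast n W = ∀ u v → W u → W v → ¬ (u ≡ v) → n ≤ dist u v

module Submission where

-- Let w be a nonzero codeword of least weight t ≥ 5 (it exists since dim W ≥ 1), and let
-- i ≠ j be two positions in its support.  Every vertex ν = (a at i', b at j', 0 elsewhere)
-- with a, b nonzero lies in W₂, and d(ν₁, w) = t - 2 for ν₁ = (w_i at i, w_j at j).  A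
-- group element moving ν₁ to ν₂ = (a at i', b at j') preserves distances and W, so
-- w' = g w is a codeword with d(ν₂, w') = t - 2; comparing with wt(w') ≥ t forces
-- w'_i' = a and w'_j' = b.  Hence every pair of nonzero letters occurs at every pair of
-- positions of some codeword ("all pairs are realised").  Then W has at least (q-1)²
-- codewords, but only p^k ≤ q of them; so q ≤ 2, i.e. p = 2 and d = k = 1, and
-- W = {0, b}.  Realising (1,1) at every pair of positions finally forces b = (1,…,1).

open import Defs
open import Data.Nat using (ℕ; zero; suc; _+_; _*_; _^_; _≤_; _<_; z≤n; s≤s; NonZero; _≤?_; _<?_)
open import Data.Nat.Properties hiding (_≟_)
open import Data.Nat.Primality using (Prime; prime)
open import Data.Nat.Base using (nonTrivial⇒n>1)
open import Data.Fin using (Fin; punchIn; remQuot) renaming (zero to fz; suc to fs)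
open import Data.Fin.Properties using (_≟_; any?; injective⇒≤; punchIn-injective; punchInᵢ≢i; *↔×)
open import Data.Vec using (Vec; []; _∷_; replicate; lookup; tabulate; head; tail; _[_]≔_)
open import Data.Vec.Properties using (≡-dec; lookup-replicate; lookup∘update′; tabulate∘lookup; tabulate-cong)
open import Data.Vec.Recursive using (Fin[m^n]↔Fin[m]^n)
open import Data.Vec.Recursive.Properties using (↔Vec)
open import Data.Product using (Σ; ∃; _×_; _,_; proj₁; proj₂)
open import Data.Sum using (_⊎_; inj₁; inj₂)
import Data.Sum
open import Relation.Nullary using (yes; no; ¬_; contradiction)
open import Relation.Nullary.Decidable using (¬?; _×-dec_)
open import Relation.Unary using (Decidable)
open import Relation.Binary.PropositionalEquality
open import Function using (_∘_)
open import Function.Bundles using (_⇔_; mk⇔; _↔_; Inverse; Injection; Equivalence)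
open import Function.Definitions using (Injective)
open import Function.Properties.Inverse using (↔-sym; ↔-trans; ↔⇒↣)
open import Algebra.Properties.CommutativeSemigroup +-commutativeSemigroup
  using (interchange; xy∙z≈zy∙x; x∙yz≈xz∙y; xy∙z≈xz∙y)

-- The Hamming metric

module _ {p d : ℕ} where

  letterDist : Q p d → Q p d → ℕ
  letterDist x y with ≡-dec _≟_ x y
  ... | yes _ = 0
  ... | no _ = 1

  letterDist≤1 : ∀ x y → letterDist x y ≤ 1
  letterDist≤1 x y with ≡-dec _≟_ x y
  ... | yes _ = z≤n
  ... | no _ = s≤s z≤n

  letterDist≡0⇒≡ : ∀ {x y} → letterDist x y ≡ 0 → x ≡ y
  letterDist≡0⇒≡ {x} {y} e with ≡-dec _≟_ x y
  ... | yes x≡y = x≡y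

  letterDist-refl : ∀ x → letterDist x x ≡ 0
  letterDist-refl x with ≡-dec _≟_ x x
  ... | yes _ = refl
  ... | no x≢x = contradiction refl x≢x

  letterDist-≢ : ∀ {x y} → ¬ x ≡ y → letterDist x y ≡ 1
  letterDist-≢ {x} {y} x≢y with ≡-dec _≟_ x y
  ... | yes x≡y = contradiction x≡y x≢y
  ... | no _ = refl

  letterDist-sym : ∀ x y → letterDist x y ≡ letterDist y x
  letterDist-sym x y with ≡-dec _≟_ x y | ≡-dec _≟_ y x
  ... | yes _ | yes _ = refl
  ... | no _ | no _ = refl
  ... | yes x≡y | no y≢x = contradiction (sym x≡y) y≢x
  ... | no x≢y | yes y≡x = contradiction (sym y≡x) x≢y

  letterDist-triangle : ∀ x y z → letterDist x z ≤ letterDist x y + letterDist y z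
  letterDist-triangle x y z with ≡-dec _≟_ x y | ≡-dec _≟_ y z | ≡-dec _≟_ x z
  ... | _ | _ | yes _ = z≤n
  ... | yes refl | yes refl | no x≢x = contradiction refl x≢x
  ... | yes _ | no _ | no _ = ≤-refl
  ... | no _ | _ | no _ = s≤s z≤n

  dist-cons : ∀ {m} x y (u v : V p d m) → dist (x ∷ u) (y ∷ v) ≡ letterDist x y + dist u v
  dist-cons x y u v with ≡-dec _≟_ x y
  ... | yes _ = refl
  ... | no _ = refl

  dist-refl : ∀ {m} (u : V p d m) → dist u u ≡ 0
  dist-refl [] = refl
  dist-refl (x ∷ u) = trans (dist-cons x x u u) (cong₂ _+_ (letterDist-refl x) (dist-refl u))

  dist-sym : ∀ {m} (u v : V p d m) → dist u v ≡ dist v u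
  dist-sym [] [] = refl
  dist-sym (x ∷ u) (y ∷ v) = begin
    dist (x ∷ u) (y ∷ v)       ≡⟨ dist-cons x y u v ⟩
    letterDist x y + dist u v  ≡⟨ cong₂ _+_ (letterDist-sym x y) (dist-sym u v) ⟩
    letterDist y x + dist v u  ≡⟨ sym (dist-cons y x v u) ⟩
    dist (y ∷ v) (x ∷ u)       ∎
    where open ≡-Reasoning

  dist-triangle : ∀ {m} (u v w : V p d m) → dist u w ≤ dist u v + dist v w
  dist-triangle [] [] [] = z≤n
  dist-triangle (x ∷ u) (y ∷ v) (z ∷ w) = begin
    dist (x ∷ u) (z ∷ w)                                          ≡⟨ dist-cons x z u w ⟩
    letterDist x z + dist u w                                     ≤⟨ +-mono-≤ (letterDist-triangle x y z) (dist-triangle u v w) ⟩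
    (letterDist x y + letterDist y z) + (dist u v + dist v w)     ≡⟨ interchange (letterDist x y) (letterDist y z) (dist u v) (dist v w) ⟩
    (letterDist x y + dist u v) + (letterDist y z + dist v w)     ≡⟨ sym (cong₂ _+_ (dist-cons x y u v) (dist-cons y z v w)) ⟩
    dist (x ∷ u) (y ∷ v) + dist (y ∷ v) (z ∷ w)                   ∎
    where open ≤-Reasoning

  dist-update : ∀ {m} (u w : V p d m) i a →
    dist (u [ i ]≔ a) w + letterDist (lookup u i) (lookup w i) ≡ dist u w + letterDist a (lookup w i)
  dist-update (x ∷ u) (y ∷ w) fz a = begin
    dist (a ∷ u) (y ∷ w) + letterDist x y        ≡⟨ cong (_+ letterDist x y) (dist-cons a y u w) ⟩
    letterDist a y + dist u w + letterDist x y   ≡⟨ xy∙z≈zy∙x (letterDist a y) (dist u w) (letterDist x y) ⟩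
    letterDist x y + dist u w + letterDist a y   ≡⟨ sym (cong (_+ letterDist a y) (dist-cons x y u w)) ⟩
    dist (x ∷ u) (y ∷ w) + letterDist a y        ∎
    where open ≡-Reasoning
  dist-update (x ∷ u) (y ∷ w) (fs i) a = begin
    dist (x ∷ (u [ i ]≔ a)) (y ∷ w) + δᵢ                  ≡⟨ cong (_+ δᵢ) (dist-cons x y (u [ i ]≔ a) w) ⟩
    letterDist x y + dist (u [ i ]≔ a) w + δᵢ            ≡⟨ +-assoc (letterDist x y) _ δᵢ ⟩
    letterDist x y + (dist (u [ i ]≔ a) w + δᵢ)          ≡⟨ cong (letterDist x y +_) (dist-update u w i a) ⟩
    letterDist x y + (dist u w + letterDist a (lookup w i)) ≡⟨ sym (+-assoc (letterDist x y) _ _) ⟩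
    letterDist x y + dist u w + letterDist a (lookup w i)   ≡⟨ sym (cong (_+ letterDist a (lookup w i)) (dist-cons x y u w)) ⟩
    dist (x ∷ u) (y ∷ w) + letterDist a (lookup w i)        ∎
    where
    open ≡-Reasoning
    δᵢ = letterDist (lookup u i) (lookup w i)

  aDifference : ∀ {m} (u v : V p d m) → 1 ≤ dist u v → Σ (Fin m) λ i → ¬ lookup u i ≡ lookup v i
  aDifference [] [] ()
  aDifference (x ∷ u) (y ∷ v) h with ≡-dec _≟_ x y
  ... | yes refl = let (i , uᵢ≢vᵢ) = aDifference u v h in fs i , uᵢ≢vᵢ
  ... | no x≢y = fz , x≢y

  twoDifferences : ∀ {m} (u v : V p d m) → 2 ≤ dist u v → Σ (Fin m) λ i → Σ (Fin m) λ j →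
    ¬ i ≡ j × ¬ lookup u i ≡ lookup v i × ¬ lookup u j ≡ lookup v j
  twoDifferences [] [] ()
  twoDifferences (x ∷ u) (y ∷ v) h with ≡-dec _≟_ x y
  ... | yes refl = let (i , j , i≢j , rest) = twoDifferences u v h in
                   fs i , fs j , i≢j ∘ Data.Fin.Properties.suc-injective , rest
  ... | no x≢y with h
  ... | s≤s h′ = let (j , uⱼ≢vⱼ) = aDifference u v h′ in fz , fs j , (λ ()) , x≢y , uⱼ≢vⱼ

-- Graph automorphisms of H(m,q) are isometries

module _ {p d m : ℕ} where

  data Walk : ℕ → V p d m → V p d m → Set where
    stay : ∀ {u} → Walk 0 u u
    step : ∀ {n u v w} → Adj u v → Walk n v w → Walk (suc n) u w

  walk⇒dist≤ : ∀ {n u v} → Walk n u v → dist u v ≤ n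
  walk⇒dist≤ {u = u} stay = ≤-reflexive (dist-refl u)
  walk⇒dist≤ {u = u} {w} (step {v = v} u~v walk) = begin
    dist u w             ≤⟨ dist-triangle u v w ⟩
    dist u v + dist v w  ≡⟨ cong (_+ dist v w) u~v ⟩
    suc (dist v w)       ≤⟨ s≤s (walk⇒dist≤ walk) ⟩
    suc _                ∎
    where open ≤-Reasoning

  mapWalk : (g : HammingAut p d m) → ∀ {n u v} → Walk n u v → Walk n (fun g u) (fun g v)
  mapWalk g stay = stay
  mapWalk g (step u~v walk) = step (Equivalence.to (adj g _ _) u~v) (mapWalk g walk)

  inverseAut : HammingAut p d m → HammingAut p d m
  inverseAut g = record
    { fun = inv g ; inv = fun g ; inv-left = inv-right g ; inv-right = inv-left g
    ; adj = λ u v → mk⇔ (λ u~v → Equivalence.from (adj g _ _) (subst₂ Adj (sym (inv-right g u)) (sym (inv-right g v)) u~v))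
                         (λ g⁻¹u~g⁻¹v → subst₂ Adj (inv-right g u) (inv-right g v) (Equivalence.to (adj g _ _) g⁻¹u~g⁻¹v))
    }

module _ {p d : ℕ} where

  prefixWalk : ∀ {m n} x {u v : V p d m} → Walk n u v → Walk n (x ∷ u) (x ∷ v)
  prefixWalk x stay = stay
  prefixWalk x (step {u = u} {v} u~v walk) =
    step (trans (dist-cons x x u v) (cong₂ _+_ (letterDist-refl x) u~v)) (prefixWalk x walk)

  geodesic : ∀ {m} (u v : V p d m) → Walk (dist u v) u v
  geodesic [] [] = stay
  geodesic (x ∷ u) (y ∷ v) with ≡-dec _≟_ x y
  ... | yes refl = prefixWalk x (geodesic u v)
  ... | no x≢y = step x∷u~y∷u (prefixWalk y (geodesic u v))
    where
    x∷u~y∷u : Adj (x ∷ u) (y ∷ u)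
    x∷u~y∷u = trans (dist-cons x y u u) (cong₂ _+_ (letterDist-≢ x≢y) (dist-refl u))

  -- Automorphisms do not increase distances, hence (applied also to the inverse) preserve them.
  dist-nonincreasing : ∀ {m} (g : HammingAut p d m) u v → dist (fun g u) (fun g v) ≤ dist u v
  dist-nonincreasing g u v = walk⇒dist≤ (mapWalk g (geodesic u v))

  dist-preserved : ∀ {m} (g : HammingAut p d m) u v → dist (fun g u) (fun g v) ≡ dist u v
  dist-preserved g u v = ≤-antisym (dist-nonincreasing g u v)
    (subst₂ (λ u′ v′ → dist u′ v′ ≤ dist (fun g u) (fun g v)) (inv-left g u) (inv-left g v)
      (dist-nonincreasing (inverseAut g) (fun g u) (fun g v)))

-- Weight-two vertices and the realisation of pairs of letters

zeroLetter : {p d : ℕ} .{{_ : NonZero p}} → Q p d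
zeroLetter {d = d} = replicate d zeroF

module _ {p d m : ℕ} .{{_ : NonZero p}} where

  lookup-zeroV : ∀ i → lookup (zeroV {p} {d} {m}) i ≡ zeroLetter
  lookup-zeroV i = lookup-replicate i zeroLetter

  weight : V p d m → ℕ
  weight = dist zeroV

  weightTwo : Fin m → Fin m → Q p d → Q p d → V p d m
  weightTwo i j a b = (zeroV [ i ]≔ a) [ j ]≔ b

  dist-weightTwo : ∀ {i j} → ¬ i ≡ j → ∀ a b c →
    dist (weightTwo i j a b) c + (letterDist zeroLetter (lookup c i) + letterDist zeroLetter (lookup c j))
      ≡ weight c + (letterDist a (lookup c i) + letterDist b (lookup c j))
  dist-weightTwo {i} {j} i≢j a b c = begin
    dist ν c + (δ₀ᵢ + δ₀ⱼ)                         ≡⟨ x∙yz≈xz∙y (dist ν c) δ₀ᵢ δ₀ⱼ ⟩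
    dist ν c + δ₀ⱼ + δ₀ᵢ                           ≡⟨ cong (λ x → dist ν c + letterDist x (lookup c j) + δ₀ᵢ) (sym uⱼ≡0) ⟩
    dist ν c + letterDist (lookup u j) (lookup c j) + δ₀ᵢ ≡⟨ cong (_+ δ₀ᵢ) (dist-update u c j b) ⟩
    dist u c + δbⱼ + δ₀ᵢ                           ≡⟨ xy∙z≈xz∙y (dist u c) δbⱼ δ₀ᵢ ⟩
    dist u c + δ₀ᵢ + δbⱼ                           ≡⟨ cong (λ x → dist u c + letterDist x (lookup c i) + δbⱼ) (sym (lookup-zeroV i)) ⟩
    dist u c + letterDist (lookup zeroV i) (lookup c i) + δbⱼ ≡⟨ cong (_+ δbⱼ) (dist-update zeroV c i a) ⟩
    weight c + δaᵢ + δbⱼ                           ≡⟨ +-assoc (weight c) δaᵢ δbⱼ ⟩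
    weight c + (δaᵢ + δbⱼ)                         ∎
    where
    open ≡-Reasoning
    u = zeroV [ i ]≔ a
    ν = weightTwo i j a b
    δ₀ᵢ = letterDist zeroLetter (lookup c i)
    δ₀ⱼ = letterDist zeroLetter (lookup c j)
    δaᵢ = letterDist a (lookup c i)
    δbⱼ = letterDist b (lookup c j)
    uⱼ≡0 : lookup u j ≡ zeroLetter
    uⱼ≡0 = trans (lookup∘update′ (i≢j ∘ sym) zeroV a) (lookup-zeroV j)

  dist-weightTwo-zero : ∀ {i j} → ¬ i ≡ j → ∀ {a b} → ¬ a ≡ zeroLetter → ¬ b ≡ zeroLetter →
    dist (weightTwo i j a b) zeroV ≡ 2
  dist-weightTwo-zero {i} {j} i≢j {a} {b} a≢0 b≢0 = begin
    dist ν zeroV                 ≡⟨ sym (+-identityʳ _) ⟩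
    dist ν zeroV + 0             ≡⟨ cong (dist ν zeroV +_) (sym (cong₂ _+_ (atZero i zeroLetter ∙ letterDist-refl zeroLetter) (atZero j zeroLetter ∙ letterDist-refl zeroLetter))) ⟩
    dist ν zeroV + (δ zeroLetter i + δ zeroLetter j) ≡⟨ dist-weightTwo i≢j a b zeroV ⟩
    weight zeroV + (δ a i + δ b j) ≡⟨ cong₂ _+_ (dist-refl (zeroV {p} {d} {m})) (cong₂ _+_ (atZero i a ∙ letterDist-≢ a≢0) (atZero j b ∙ letterDist-≢ b≢0)) ⟩
    2                            ∎
    where
    open ≡-Reasoning
    _∙_ = trans
    ν = weightTwo i j a b
    δ : Q p d → Fin m → ℕ
    δ x k = letterDist x (lookup zeroV k)
    atZero : ∀ k x → δ x k ≡ letterDist x zeroLetter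
    atZero k x = cong (letterDist x) (lookup-zeroV k)

  supportPair : ∀ (w : V p d m) → 2 ≤ weight w → Σ (Fin m) λ i → Σ (Fin m) λ j →
    ¬ i ≡ j × ¬ lookup w i ≡ zeroLetter × ¬ lookup w j ≡ zeroLetter
  supportPair w 2≤wt =
    let (i , j , i≢j , 0≢wᵢ , 0≢wⱼ) = twoDifferences zeroV w 2≤wt in
    i , j , i≢j , (λ e → 0≢wᵢ (trans (lookup-zeroV i) (sym e))) , (λ e → 0≢wⱼ (trans (lookup-zeroV j) (sym e)))

  MinimumWeight : Code p d m → V p d m → Set
  MinimumWeight W w = W w × ¬ w ≡ zeroV × (∀ c → W c → ¬ c ≡ zeroV → weight w ≤ weight c)

  PairsRealised : Code p d m → Set
  PairsRealised W = ∀ i j → ¬ i ≡ j → ∀ a b → ¬ a ≡ zeroLetter → ¬ b ≡ zeroLetter →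
    Σ (V p d m) λ c → W c × lookup c i ≡ a × lookup c j ≡ b

surplus-zero : ∀ m {n} → m + n ≤ m → n ≡ 0
surplus-zero m {n} h = n≤0⇒n≡0 (+-cancelˡ-≤ m n 0 (≤-trans h (≤-reflexive (sym (+-identityʳ m)))))

module Realisation {p d m : ℕ} .{{_ : NonZero p}} (W : Code p d m) (W0 : W zeroV)
                   (mind : MinDistAtLeast 5 W) where

  -- Weight-two vertices lie in W₂: at distance 2 from 0, and at least 3 from other codewords.
  weightTwo∈W₂ : ∀ {i j} → ¬ i ≡ j → ∀ {a b} → ¬ a ≡ zeroLetter → ¬ b ≡ zeroLetter →
    DistSet W 2 (weightTwo i j a b)
  weightTwo∈W₂ i≢j a≢0 b≢0 = (zeroV , W0 , ν-weight) , atLeastTwo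
    where
    ν = weightTwo _ _ _ _
    ν-weight : dist ν zeroV ≡ 2
    ν-weight = dist-weightTwo-zero i≢j a≢0 b≢0
    atLeastTwo : ∀ c → W c → 2 ≤ dist ν c
    atLeastTwo c Wc with ≡-dec (≡-dec _≟_) c zeroV
    ... | yes refl = ≤-reflexive (sym ν-weight)
    ... | no c≢0 = ≤-trans (n≤1+n 2) (+-cancelˡ-≤ 2 3 (dist ν c) (begin
      5                      ≤⟨ mind zeroV c W0 Wc (c≢0 ∘ sym) ⟩
      dist zeroV c           ≤⟨ dist-triangle zeroV ν c ⟩
      dist zeroV ν + dist ν c ≡⟨ cong (_+ dist ν c) (trans (dist-sym zeroV ν) ν-weight) ⟩
      2 + dist ν c           ∎))
      where open ≤-Reasoning

  minimumWeight≥5 : ∀ {w} → MinimumWeight W w → 5 ≤ weight w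
  minimumWeight≥5 {w} (Ww , w≢0 , _) = mind zeroV w W0 Ww (w≢0 ∘ sym)

  minimumWeightSupport : ∀ {w} → MinimumWeight W w → Σ (Fin m) λ i → Σ (Fin m) λ j →
    ¬ i ≡ j × ¬ lookup w i ≡ zeroLetter × ¬ lookup w j ≡ zeroLetter
  minimumWeightSupport {w} minW = supportPair w (≤-trans (s≤s (s≤s z≤n)) (minimumWeight≥5 minW))

  imageRealisesPair : ∀ {w} → MinimumWeight W w →
    ∀ {i j} → ¬ i ≡ j → ¬ lookup w i ≡ zeroLetter → ¬ lookup w j ≡ zeroLetter →
    ∀ {i′ j′} → ¬ i′ ≡ j′ → ∀ {a b} → ¬ a ≡ zeroLetter → ¬ b ≡ zeroLetter →
    (g : HammingAut p d m) → Stabilises W g →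
    fun g (weightTwo i j (lookup w i) (lookup w j)) ≡ weightTwo i′ j′ a b →
    lookup (fun g w) i′ ≡ a × lookup (fun g w) j′ ≡ b
  imageRealisesPair {w} minW@(Ww , w≢0 , least) {i} {j} i≢j wᵢ≢0 wⱼ≢0 {i′} {j′} i′≢j′ {a} {b} a≢0 b≢0 g stab gν₁≡ν₂ =
    sym (letterDist≡0⇒≡ (m+n≡0⇒m≡0 _ noSurplus)) , sym (letterDist≡0⇒≡ (m+n≡0⇒n≡0 _ noSurplus))
    where
    ν₁ = weightTwo i j (lookup w i) (lookup w j)
    ν₂ = weightTwo i′ j′ a b
    w′ = fun g w
    Ww′ : W w′
    Ww′ = Equivalence.to (stab w) Ww
    -- g is an isometry, so d(ν₂, w′) = d(ν₁, w).
    distν₂w′ : dist ν₂ w′ ≡ dist ν₁ w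
    distν₂w′ = trans (cong (λ v → dist v w′) (sym gν₁≡ν₂)) (dist-preserved g ν₁ w)
    -- ν₁ agrees with w at i and j, and is 0 elsewhere: d(ν₁, w) + 2 = wt(w).
    distν₁w : dist ν₁ w + 2 ≡ weight w
    distν₁w = begin
      dist ν₁ w + 2 ≡⟨ cong (dist ν₁ w +_) (sym (cong₂ _+_ (letterDist-≢ {x = zeroLetter} (wᵢ≢0 ∘ sym)) (letterDist-≢ {x = zeroLetter} (wⱼ≢0 ∘ sym)))) ⟩
      dist ν₁ w + (letterDist zeroLetter (lookup w i) + letterDist zeroLetter (lookup w j))
        ≡⟨ dist-weightTwo i≢j (lookup w i) (lookup w j) w ⟩
      weight w + (letterDist (lookup w i) (lookup w i) + letterDist (lookup w j) (lookup w j))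
        ≡⟨ cong (weight w +_) (cong₂ _+_ (letterDist-refl (lookup w i)) (letterDist-refl (lookup w j))) ⟩
      weight w + 0 ≡⟨ +-identityʳ _ ⟩
      weight w ∎
      where open ≡-Reasoning
    -- w′ ≠ 0, for otherwise wt(w) = d(ν₂, 0) + 2 = 4 < 5.
    w′≢0 : ¬ w′ ≡ zeroV
    w′≢0 w′≡0 = <⇒≱ (s≤s (s≤s (s≤s (s≤s (s≤s z≤n))))) (≤-trans (minimumWeight≥5 minW) (≤-reflexive (begin
      weight w          ≡⟨ sym distν₁w ⟩
      dist ν₁ w + 2     ≡⟨ cong (_+ 2) (sym distν₂w′) ⟩
      dist ν₂ w′ + 2    ≡⟨ cong (λ v → dist ν₂ v + 2) w′≡0 ⟩
      dist ν₂ zeroV + 2 ≡⟨ cong (_+ 2) (dist-weightTwo-zero i′≢j′ a≢0 b≢0) ⟩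
      4                 ∎)))
      where open ≡-Reasoning
    -- wt(w′) + [w′ᵢ′ ≠ a] + [w′ⱼ′ ≠ b] = d(ν₂, w′) + [w′ᵢ′ ≠ 0] + [w′ⱼ′ ≠ 0] ≤ wt(w) ≤ wt(w′).
    noSurplus : letterDist a (lookup w′ i′) + letterDist b (lookup w′ j′) ≡ 0
    noSurplus = surplus-zero (weight w′) (begin
      weight w′ + (letterDist a (lookup w′ i′) + letterDist b (lookup w′ j′))
        ≡⟨ sym (dist-weightTwo i′≢j′ a b w′) ⟩
      dist ν₂ w′ + (letterDist zeroLetter (lookup w′ i′) + letterDist zeroLetter (lookup w′ j′))
        ≤⟨ +-monoʳ-≤ (dist ν₂ w′) (+-mono-≤ (letterDist≤1 zeroLetter (lookup w′ i′)) (letterDist≤1 zeroLetter (lookup w′ j′))) ⟩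
      dist ν₂ w′ + 2 ≡⟨ cong (_+ 2) distν₂w′ ⟩
      dist ν₁ w + 2  ≡⟨ distν₁w ⟩
      weight w       ≤⟨ least w′ Ww′ w′≢0 ⟩
      weight w′      ∎)
      where open ≤-Reasoning

  realise : ∀ {w} → MinimumWeight W w → (X : HammingAut p d m → Set) →
    (∀ x → X x → Stabilises W x) → TransitiveOn X (DistSet W 2) → PairsRealised W
  realise {w} minW@(Ww , _) X stab tr₂ i′ j′ i′≢j′ a b a≢0 b≢0
    with minimumWeightSupport minW
  ... | i , j , i≢j , wᵢ≢0 , wⱼ≢0
    with tr₂ _ _ (weightTwo∈W₂ i≢j wᵢ≢0 wⱼ≢0) (weightTwo∈W₂ i′≢j′ a≢0 b≢0)
  ... | g , Xg , gν₁≡ν₂ =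
    fun g w , Equivalence.to (stab g Xg w) Ww ,
    imageRealisesPair minW i≢j wᵢ≢0 wⱼ≢0 i′≢j′ a≢0 b≢0 g (stab g Xg) gν₁≡ν₂

-- Finite enumeration: least-weight codewords and counting

vectorCode : ∀ {p} n → Vec (Fin p) n ↔ Fin (p ^ n)
vectorCode {p} n = ↔-sym (↔-trans (Fin[m^n]↔Fin[m]^n p n) (↔Vec n))

leastWitness : ∀ {n} (P : Fin n → Set) → Decidable P → (f : Fin n → ℕ) → ∃ P →
  Σ (Fin n) λ s → P s × (∀ t → P t → f s ≤ f t)
leastWitness P P? f (s , Ps) = descend (f s) s Ps ≤-refl
  where
  -- descend through witnesses of strictly decreasing measure, bounded by `bound`
  descend : ∀ bound s → P s → f s ≤ bound → Σ _ λ s → P s × (∀ t → P t → f s ≤ f t)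
  descend bound s Ps fs≤bound with any? (λ t → P? t ×-dec (f t <? f s))
  ... | no noneSmaller = s , Ps , λ t Pt → ≮⇒≥ (λ ft<fs → noneSmaller (t , Pt , ft<fs))
  descend zero s Ps fs≤0 | yes (t , _ , ft<fs) = contradiction (≤-trans ft<fs fs≤0) n≮0
  descend (suc bound) s Ps fs≤bound | yes (t , Pt , ft<fs) =
    descend bound t Pt (≤-pred (≤-trans ft<fs fs≤bound))

injection-bound : ∀ {A : Set} {n N} → A ↔ Fin N → (f : Fin n → A) → Injective _≡_ _≡_ f → n ≤ N
injection-bound A↔Fin f f-inj =
  injective⇒≤ {f = Inverse.to A↔Fin ∘ f} (f-inj ∘ Injection.injective (↔⇒↣ A↔Fin))

avoidingInjection : ∀ {A : Set} {n} → A ↔ Fin (suc n) → (z : A) →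
  Σ (Fin n → A) λ f → Injective _≡_ _≡_ f × (∀ r → ¬ f r ≡ z)
avoidingInjection A↔Fin z =
  (λ r → from (punchIn (to z) r)) ,
  (λ e → punchIn-injective (to z) _ _ (Injection.injective (↔⇒↣ (↔-sym A↔Fin)) e)) ,
  (λ r e → punchInᵢ≢i (to z) r (trans (sym (Inverse.strictlyInverseˡ A↔Fin _)) (cong to e)))
  where open Inverse A↔Fin using (to; from)

module _ {p d m k : ℕ} .{{_ : NonZero p}} (W : Code p d m) (bs : Vec (V p d m) k)
         (inW : ∀ c → W (lincomb bs c)) (repr : ∀ w → W w → Σ (Vec (Fin p) k) λ c → lincomb bs c ≡ w) where

  codeword : Fin (p ^ k) → V p d m
  codeword s = lincomb bs (Inverse.from (vectorCode k) s)

  codewordIndex : ∀ c → W c → Σ (Fin (p ^ k)) λ s → codeword s ≡ c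
  codewordIndex c Wc =
    let (coeffs , e) = repr c Wc in
    Inverse.to (vectorCode k) coeffs , trans (cong (lincomb bs) (Inverse.strictlyInverseʳ (vectorCode k) coeffs)) e

  minimumWeightCodeword : ∀ w → W w → ¬ w ≡ zeroV → Σ (V p d m) (MinimumWeight W)
  minimumWeightCodeword w Ww w≢0 =
    let (s , cₛ≢0 , least) = leastWitness (λ s → ¬ codeword s ≡ zeroV) (λ s → ¬? (≡-dec (≡-dec _≟_) (codeword s) zeroV))
                                          (weight ∘ codeword) (initial (codewordIndex w Ww))
    in codeword s , inW (Inverse.from (vectorCode k) s) , cₛ≢0 , λ c Wc c≢0 →
         let (t , cₜ≡c) = codewordIndex c Wc in
         subst (λ v → weight (codeword s) ≤ weight v) cₜ≡c (least t (c≢0 ∘ trans (sym cₜ≡c)))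
    where
    initial : Σ (Fin (p ^ k)) (λ s → codeword s ≡ w) → ∃ λ s → ¬ codeword s ≡ zeroV
    initial (s , e) = s , w≢0 ∘ trans (sym e)

anotherElement : ∀ {p} → 1 < p → (x : Fin p) → Σ (Fin p) λ y → ¬ y ≡ x
anotherElement (s≤s (s≤s z≤n)) fz = fs fz , λ ()
anotherElement (s≤s (s≤s z≤n)) (fs x) = fz , λ ()

-- A code with a basis of k ≥ 1 vectors over a field with p ≥ 2 elements has a nonzero
-- codeword: change one coefficient of the representation of 0.
nonzeroCodeword : ∀ {p d m k} .{{_ : NonZero p}} → 1 < p → (W : Code p d m) → W zeroV →
  (bs : Vec (V p d m) (suc k)) → (∀ c → W (lincomb bs c)) →
  (∀ w → W w → Σ (Vec (Fin p) (suc k)) λ c → lincomb bs c ≡ w) →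
  (∀ c c′ → lincomb bs c ≡ lincomb bs c′ → c ≡ c′) →
  Σ (V p d m) λ w → W w × ¬ w ≡ zeroV
nonzeroCodeword 1<p W W0 bs inW repr indep =
  let (c₀ , c₀↦0) = repr zeroV W0
      (x , x≢c₀₁) = anotherElement 1<p (head c₀)
  in lincomb bs (x ∷ tail c₀) , inW (x ∷ tail c₀) ,
     λ c₁↦0 → x≢c₀₁ (cong head (indep (x ∷ tail c₀) c₀ (trans c₁↦0 (sym c₀↦0))))

squareExceeds : ∀ q → 2 ≤ q → suc q < q * q
squareExceeds q 2≤q = begin
  2 + q      ≤⟨ +-monoˡ-≤ q 2≤q ⟩
  q + q      ≡⟨ cong (q +_) (sym (*-identityʳ q)) ⟩
  q + q * 1  ≡⟨ sym (*-suc q 1) ⟩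
  q * 2      ≤⟨ *-monoʳ-≤ q 2≤q ⟩
  q * q      ∎
  where open ≤-Reasoning

splitOffThree : ∀ {n} → 3 ≤ n → Σ ℕ λ q′ → n ≡ suc q′ × 2 ≤ q′
splitOffThree {suc q′} (s≤s 2≤q′) = q′ , refl , 2≤q′

-- With q = p^d ≥ 3 letters, a code spanned by k ≤ d vectors has at most p^k ≤ q codewords,
-- too few to realise all (q-1)² > q pairs of nonzero letters at two given positions.
pairsNotRealised : ∀ {p d m k} .{{_ : NonZero p}} (W : Code p d m) (bs : Vec (V p d m) k) →
  (∀ w → W w → Σ (Vec (Fin p) k) λ c → lincomb bs c ≡ w) →
  3 ≤ p ^ d → k ≤ d → ∀ {i j : Fin m} → ¬ i ≡ j → ¬ PairsRealised W
pairsNotRealised {p} {d} {m} {k} W bs repr 3≤q k≤d {i} {j} i≢j realised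
  with splitOffThree 3≤q
... | q′ , q≡1+q′ , 2≤q′ = <⇒≱ (squareExceeds q′ 2≤q′) (begin
  q′ * q′  ≤⟨ injection-bound (vectorCode k) coefficients coefficients-injective ⟩
  p ^ k    ≤⟨ ^-monoʳ-≤ p k≤d ⟩
  p ^ d    ≡⟨ q≡1+q′ ⟩
  suc q′   ∎)
  where
  open ≤-Reasoning
  -- the q′ = q - 1 nonzero letters, listed injectively
  nonzeroLetters = avoidingInjection (subst (λ N → Q p d ↔ Fin N) q≡1+q′ (vectorCode d)) zeroLetter
  letter : Fin q′ → Q p d
  letter = proj₁ nonzeroLetters
  pairOf : Fin (q′ * q′) → Fin q′ × Fin q′
  pairOf = remQuot q′
  realisedAt : ∀ r → Σ (V p d m) λ c → W c × lookup c i ≡ letter (proj₁ (pairOf r)) × lookup c j ≡ letter (proj₂ (pairOf r))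
  realisedAt r = realised i j i≢j _ _ (proj₂ (proj₂ nonzeroLetters) _) (proj₂ (proj₂ nonzeroLetters) _)
  coefficients : Fin (q′ * q′) → Vec (Fin p) k
  coefficients r = proj₁ (repr (proj₁ (realisedAt r)) (proj₁ (proj₂ (realisedAt r))))
  -- equal coefficients give equal codewords, hence equal letters at i and j, hence equal pairs
  coefficients-injective : Injective _≡_ _≡_ coefficients
  coefficients-injective {r} {r′} e =
    Injection.injective (↔⇒↣ (*↔× {q′} {q′})) (cong₂ _,_ (sameLetter {sel = proj₁} (λ r → proj₁ (proj₂ (proj₂ (realisedAt r)))))
                                              (sameLetter {sel = proj₂} (λ r → proj₂ (proj₂ (proj₂ (realisedAt r))))))
    where
    c = proj₁ ∘ realisedAt
    cᵣ≡cᵣ′ : c r ≡ c r′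
    cᵣ≡cᵣ′ = trans (sym (proj₂ (repr (c r) _))) (trans (cong (lincomb bs) e) (proj₂ (repr (c r′) _)))
    sameLetter : ∀ {l} {sel : Fin q′ × Fin q′ → Fin q′} → (∀ r → lookup (c r) l ≡ letter (sel (pairOf r))) → sel (pairOf r) ≡ sel (pairOf r′)
    sameLetter at = proj₁ (proj₂ nonzeroLetters) (trans (sym (at r)) (trans (cong (λ v → lookup v _) cᵣ≡cᵣ′) (at r′)))

-- The binary case

binaryParameters : ∀ {p d k} .{{_ : NonZero p}} → 1 < p → ¬ 3 ≤ p ^ d → suc k ≤ d → p ≡ 2 × d ≡ 1 × k ≡ 0
binaryParameters {p} {suc zero} 1<p q≱3 (s≤s k≤0) =
  ≤-antisym (≤-pred (subst (_< 3) (*-identityʳ p) (≰⇒> q≱3))) 1<p , refl , n≤0⇒n≡0 k≤0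
binaryParameters {p} {suc (suc d)} 1<p q≱3 _ = contradiction (begin
  3                    ≤⟨ n≤1+n 3 ⟩
  2 * (2 * 1)          ≤⟨ *-mono-≤ 1<p (*-mono-≤ 1<p (m^n>0 p d)) ⟩
  p * (p * p ^ d)      ∎) q≱3
  where open ≤-Reasoning

one : Q 2 1
one = fs fz ∷ []

addZero : ∀ {m} → (w : V 2 1 m) → addV w zeroV ≡ w
addZero [] = refl
addZero ((fz ∷ []) ∷ w) = cong (_ ∷_) (addZero w)
addZero ((fs fz ∷ []) ∷ w) = cong (_ ∷_) (addZero w)

scaleZero : ∀ {m} → (w : V 2 1 m) → scaleV fz w ≡ zeroV
scaleZero [] = refl
scaleZero ((_ ∷ []) ∷ w) = cong (_ ∷_) (scaleZero w)

scaleOne : ∀ {m} → (w : V 2 1 m) → scaleV (fs fz) w ≡ w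
scaleOne [] = refl
scaleOne ((fz ∷ []) ∷ w) = cong (_ ∷_) (scaleOne w)
scaleOne ((fs fz ∷ []) ∷ w) = cong (_ ∷_) (scaleOne w)

lincomb-one : ∀ {m} → (b : V 2 1 m) → lincomb (b ∷ []) (fs fz ∷ []) ≡ b
lincomb-one b = trans (cong (λ v → addV v zeroV) (scaleOne b)) (addZero b)

span₂ : ∀ {m} → (b : V 2 1 m) → ∀ c → lincomb (b ∷ []) c ≡ zeroV ⊎ lincomb (b ∷ []) c ≡ b
span₂ b (fz ∷ []) = inj₁ (trans (cong (λ v → addV v zeroV) (scaleZero b)) (addZero zeroV))
span₂ b (fs fz ∷ []) = inj₂ (lincomb-one b)

anotherPosition : ∀ {m} {i j : Fin m} → ¬ i ≡ j → ∀ l → Σ (Fin m) λ l′ → ¬ l ≡ l′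
anotherPosition {i = i} {j} i≢j l with i ≟ l
... | yes refl = j , i≢j
... | no i≢l = i , i≢l ∘ sym

repetitionCode : ∀ {m} (W : Code 2 1 m) → W zeroV → (bs : Vec (V 2 1 m) 1) → (∀ c → W (lincomb bs c)) →
  (∀ w → W w → Σ (Vec (Fin 2) 1) λ c → lincomb bs c ≡ w) →
  (∀ (l : Fin m) → Σ (Fin m) λ l′ → ¬ l ≡ l′) → PairsRealised W →
  ∀ v → W v ⇔ (v ≡ zeroV ⊎ v ≡ onesV)
repetitionCode W W0 (b ∷ []) inW repr partner realised v = mk⇔ forward backward
  where
  inSpan : ∀ c → W c → c ≡ zeroV ⊎ c ≡ b
  inSpan c Wc = let (coeffs , e) = repr c Wc in Data.Sum.map (trans (sym e)) (trans (sym e)) (span₂ b coeffs)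

  -- the codeword realising (1, 1) at l and a partner position is nonzero, hence equals b
  bₗ≡one : ∀ l → lookup b l ≡ one
  bₗ≡one l with partner l
  ... | l′ , l≢l′ with realised l l′ l≢l′ one one (λ ()) (λ ())
  ... | c , Wc , cₗ≡one , _ with inSpan c Wc
  ... | inj₁ refl = contradiction (trans (sym (lookup-zeroV l)) cₗ≡one) λ ()
  ... | inj₂ refl = cₗ≡one

  b≡ones : b ≡ onesV
  b≡ones = begin
    b                         ≡⟨ sym (tabulate∘lookup b) ⟩
    tabulate (lookup b)       ≡⟨ tabulate-cong (λ l → trans (bₗ≡one l) (sym (lookup-replicate l one))) ⟩
    tabulate (lookup onesV)   ≡⟨ tabulate∘lookup onesV ⟩
    onesV                     ∎
    where open ≡-Reasoning

  forward : W v → v ≡ zeroV ⊎ v ≡ onesV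
  forward Wv = Data.Sum.map₂ (λ v≡b → trans v≡b b≡ones) (inSpan v Wv)

  backward : v ≡ zeroV ⊎ v ≡ onesV → W v
  backward (inj₁ refl) = W0
  backward (inj₂ refl) = subst W (trans (lincomb-one b) b≡ones) (inW (fs fz ∷ []))

lemma3p3 : (p d m k : ℕ) .{{_ : NonZero p}} → Prime p
    → (W : Code p d m) → IsSubspace W → HasDim W k → 1 ≤ k → k ≤ d
    → (X : HammingAut p d m → Set) → IsSubgroup X → (∀ x → X x → Stabilises W x)
    → NeighbourTransitive2 X W → MinDistAtLeast 5 W
    → (p ^ d ≡ 2) × (∀ v → W v ⇔ (v ≡ zeroV ⊎ v ≡ onesV))
lemma3p3 p d m (suc k) (prime {{nontrivial}} _) W (W0 , _) (bs , inW , repr , indep) _ 1+k≤d X _ stab (_ , _ , tr₂) mind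
  with nonzeroCodeword (nonTrivial⇒n>1 p) W W0 bs inW repr indep
... | w₀ , Ww₀ , w₀≢0 with minimumWeightCodeword W bs inW repr w₀ Ww₀ w₀≢0
... | w , minW with Realisation.minimumWeightSupport W W0 mind minW | 3 ≤? p ^ d
-- q ≥ 3: W is too small to realise all pairs of nonzero letters
... | i , j , i≢j , _ | yes 3≤q =
  contradiction (Realisation.realise W W0 mind minW X stab tr₂) (pairsNotRealised W bs repr 3≤q 1+k≤d i≢j)
-- q = 2: W is spanned by one vector, which realisation forces to be the all-ones word
... | i , j , i≢j , _ | no q≱3 with binaryParameters (nonTrivial⇒n>1 p) q≱3 1+k≤d
... | refl , refl , refl =
  refl , repetitionCode W W0 bs inW repr (anotherPosition i≢j) (Realisation.realise W W0 mind minW X stab tr₂)
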